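{- Let $\beta\in S_n$ be a permutation whose cycle type does not consist of distinct odd integers (i.e., it is not the case that all cycle lengths of $\beta$, counting fixed points as $1$-cycles, are odd and pairwise distinct). Then, for every nonnegative integer $k$, exactly one half of the permutations in $C(k,\beta)=\{\alpha\in S_n:H(\alpha\beta,\beta\alpha)=k\}$ are odd.
   Context: $H(\sigma,\tau)=|\{a\in[n]:\sigma(a)\ne\tau(a)\}|$ is the Hamming metric on $S_n$. -}

module Defs where

open import Data.Nat using (ℕ; zero; suc; _%_; _≤_; _<_)
open import Data.Nat.Properties using () renaming (_≟_ to _≟ℕ_)
open import Data.Fin using (Fin; zero; suc) renaming (_<_ to _<ᶠ_)
open import Data.Fin.Properties using (all?; _≟_) renaming (_<?_ to _<ᶠ?_)
open import Data.List using (List; []; _∷_; [_]; map; concatMap; filter; length; allFin; cartesianProduct)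
open import Data.Product using (_×_; _,_; proj₁; proj₂; ∃-syntax)
open import Relation.Nullary using (¬_; Dec)
open import Relation.Nullary.Decidable using (_→-dec_; _×-dec_; ¬?)
import Agda.Primitive
open import Relation.Unary using (Pred; Decidable)
open import Relation.Binary.PropositionalEquality using (_≡_; _≢_)

count : ∀ {A : Set} {P : Pred A Agda.Primitive.lzero} → Decidable P → List A → ℕ
count P? xs = length (filter P? xs)

cons : ∀ {m n} → Fin n → (Fin m → Fin n) → Fin (suc m) → Fin n
cons x f zero    = x
cons x f (suc i) = f i

allFuns : (m n : ℕ) → List (Fin m → Fin n)
allFuns zero    n = [ (λ ()) ]
allFuns (suc m) n = concatMap (λ f → map (λ x → cons x f) (allFin n)) (allFuns m n)

-- a map Fin n → Fin n is a permutation iff it is injective (finite set)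
IsPerm : ∀ {n} → (Fin n → Fin n) → Set
IsPerm f = ∀ i j → f i ≡ f j → i ≡ j

isPerm? : ∀ {n} → Decidable (IsPerm {n})
isPerm? f = all? (λ i → all? (λ j → (f i ≟ f j) →-dec (i ≟ j)))

Sym : (n : ℕ) → List (Fin n → Fin n)
Sym n = filter isPerm? (allFuns n n)

H : ∀ {n} → (Fin n → Fin n) → (Fin n → Fin n) → ℕ
H σ τ = count (λ a → ¬? (σ a ≟ τ a)) (allFin _)

C : ∀ {n} → ℕ → (Fin n → Fin n) → List (Fin n → Fin n)
C k β = filter (λ α → H (λ a → α (β a)) (λ a → β (α a)) ≟ℕ k) (Sym _)

inversions : ∀ {n} → (Fin n → Fin n) → ℕ
inversions {n} σ =
  count (λ p → (proj₁ p <ᶠ? proj₂ p) ×-dec (σ (proj₂ p) <ᶠ? σ (proj₁ p)))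
        (cartesianProduct (allFin n) (allFin n))

IsOdd : ∀ {n} → (Fin n → Fin n) → Set
IsOdd σ = inversions σ % 2 ≡ 1

isOdd? : ∀ {n} → Decidable (IsOdd {n})
isOdd? σ = inversions σ % 2 ≟ℕ 1

iter : ∀ {n} → (Fin n → Fin n) → ℕ → Fin n → Fin n
iter β zero    a = a
iter β (suc m) a = β (iter β m a)

IsCycleLen : ∀ {n} → (Fin n → Fin n) → Fin n → ℕ → Set
IsCycleLen β a m = 1 ≤ m × iter β m a ≡ a × (∀ j → 1 ≤ j → j < m → iter β j a ≢ a)

-- the cycle type of β consists of distinct odd integers:
-- every cycle has odd length, and two points whose cycles have the same
-- length lie in the same cycle
DistinctOddCycleType : ∀ {n} → (Fin n → Fin n) → Set
DistinctOddCycleType β =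
  (∀ a m → IsCycleLen β a m → m % 2 ≡ 1) ×
  (∀ a b m → IsCycleLen β a m → IsCycleLen β b m → ∃[ j ] iter β j a ≡ b)

-- If β commutes with an odd permutation τ, then α ↦ ατ maps C(k,β) onto itself and changes
-- parity: H(ατβ, βατ) = H(αβτ, βατ) = H(αβ, βα), reindexing the points by τ. Such a τ exists
-- unless the cycle type of β consists of distinct odd numbers: an even cycle of β is itself a
-- product of an odd number of transpositions, and two cycles of the same odd length m are
-- exchanged pointwise by a product of m disjoint transpositions.
-- Parity is that of the number of inversions: composing with an adjacent transposition changes
-- it by exactly one, and (i j) = (i k)(k j)(i k) with k = i + 1 reduces every transposition to
-- adjacent ones.
module Submission where

open import Defs
open import Level using (0ℓ)
open import Function using (_∘_; id; case_of_)
open import Function.Definitions using (Congruent)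
open import Data.Nat using (ℕ; zero; suc; _+_; _*_; _∸_; _%_; _≤_; _<_; s≤s; z≤n; parity)
open import Data.Nat.Properties using () renaming (_≟_ to _≟ℕ_)
open import Data.Nat.Properties using
  ( +-assoc; +-comm; +-suc; +-identityʳ; +-cancelˡ-≡; +-commutativeSemigroup
  ; *-comm; *-suc; *-identityʳ; *-distribʳ-+
  ; ≤-refl; ≤-trans; ≤-reflexive; ≤-pred; ≤-<-trans; <-irrefl; <-asym; <-trans; <-cmp; <⇒≤; <⇒≢
  ; ≤∧≢⇒<; n<1+n; n≤1+n; m≤n+m; m≤n⇒m≤1+n; m<n⇒m<1+n; m≤n⇒m<n∨m≡n
  ; m∸n+n≡m; m∸n≤m; m<n⇒0<n∸m; m+[n∸m]≡n )
open import Data.Nat.DivMod using (_/_; m≡m%n+[m/n]*n; m%n<n)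
open import Algebra.Properties.CommutativeSemigroup +-commutativeSemigroup using (x∙yz≈y∙xz)
open import Data.Parity.Base using (Parity; 0ℙ; 1ℙ; _⁻¹)
import Data.Parity.Base as ℙ
open import Data.Parity.Properties using (⁻¹-selfInverse; ⁻¹-involutive; p≢p⁻¹; suc-homo-⁻¹)
open import Data.Fin using (Fin; zero; suc; toℕ; fromℕ<) renaming (_<_ to _<ᶠ_)
import Data.Fin.Properties as F
open import Data.Fin.Permutation.Components using (transpose; transpose-inverse)
open import Data.List
  using (List; []; _∷_; _++_; map; concatMap; filter; length; allFin; applyDownFrom; tabulate; cartesianProduct)
open import Data.List.Properties
  using (filter-++; length-++; filter-≐; filter-none; map-tabulate; length-applyDownFrom)
open import Data.List.Relation.Unary.All using (All; []; _∷_)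
import Data.List.Relation.Unary.All as All
open import Data.Product using (Σ; _×_; _,_; proj₁; proj₂; Σ-syntax; ∃-syntax)
open import Data.Product.Properties using () renaming (≡-dec to ×-≡-dec)
open import Data.Sum using (_⊎_; inj₁; inj₂)
open import Data.Empty using (⊥-elim)
open import Relation.Nullary using (¬_; Dec; yes; no)
open import Relation.Nullary.Decidable using (_×-dec_; ¬?; map′; dec-true; dec-false; decidable-stable)
open import Relation.Unary using (Pred; Decidable; ∁; _∩_)
open import Relation.Unary.Properties using (∁?; _∩?_)
open import Relation.Binary using (tri<; tri≈; tri>; DecSetoid; DecidableEquality; _Respects_)
open import Relation.Binary.PropositionalEquality
  using (_≡_; _≢_; _≗_; refl; sym; trans; cong; cong₂; subst; subst₂; decSetoid; module ≡-Reasoning)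

indicator : {P : Set} → Dec P → ℕ
indicator (yes _) = 1
indicator (no _)  = 0

indicator-cong : {P Q : Set} → (P → Q) → (Q → P) → (p : Dec P) (q : Dec Q) → indicator p ≡ indicator q
indicator-cong f g (yes p) (yes q) = refl
indicator-cong f g (yes p) (no ¬q) = ⊥-elim (¬q (f p))
indicator-cong f g (no ¬p) (yes q) = ⊥-elim (¬p (g q))
indicator-cong f g (no ¬p) (no ¬q) = refl

indicator-yes : {P : Set} → P → (d : Dec P) → indicator d ≡ 1
indicator-yes p (yes _) = refl
indicator-yes p (no ¬p) = ⊥-elim (¬p p)

indicator-no : {P : Set} → ¬ P → (d : Dec P) → indicator d ≡ 0
indicator-no ¬p (yes p) = ⊥-elim (¬p p)
indicator-no ¬p (no _) = refl

private variable
  A B : Set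
  P Q : Pred A 0ℓ

count-∷ : (P? : Decidable P) → ∀ x xs → count P? (x ∷ xs) ≡ indicator (P? x) + count P? xs
count-∷ P? x xs with P? x
... | yes _ = refl
... | no _  = refl

count-++ : (P? : Decidable P) → ∀ xs ys → count P? (xs ++ ys) ≡ count P? xs + count P? ys
count-++ P? xs ys = trans (cong length (filter-++ P? xs ys)) (length-++ (filter P? xs))

count-none : (P? : Decidable P) → (∀ x → ¬ P x) → ∀ xs → count P? xs ≡ 0
count-none P? ¬P xs = cong length (filter-none P? (All.universal ¬P xs))

count-≐ : (P? : Decidable P) (Q? : Decidable Q) → (∀ {x} → P x → Q x) → (∀ {x} → Q x → P x) →
  ∀ xs → count P? xs ≡ count Q? xs
count-≐ P? Q? f g xs = cong length (filter-≐ P? Q? (f , g) xs)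

count-map : (P? : Decidable P) (f : B → A) → ∀ xs → count P? (map f xs) ≡ count (P? ∘ f) xs
count-map P? f [] = refl
count-map P? f (x ∷ xs) with P? (f x)
... | yes _ = cong suc (count-map P? f xs)
... | no _  = count-map P? f xs

count-concatMap : (P? : Decidable P) (Q? : Decidable Q) (F : B → List A) →
  (∀ x → count P? (F x) ≡ indicator (Q? x)) → ∀ xs → count P? (concatMap F xs) ≡ count Q? xs
count-concatMap P? Q? F block [] = refl
count-concatMap P? Q? F block (x ∷ xs) = begin
  count P? (F x ++ concatMap F xs)           ≡⟨ count-++ P? (F x) (concatMap F xs) ⟩
  count P? (F x) + count P? (concatMap F xs) ≡⟨ cong₂ _+_ (block x) (count-concatMap P? Q? F block xs) ⟩
  indicator (Q? x) + count Q? xs             ≡⟨ count-∷ Q? x xs ⟨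
  count Q? (x ∷ xs)                          ∎
  where open ≡-Reasoning

count-filter : (P? : Decidable P) (Q? : Decidable Q) → ∀ xs → count P? (filter Q? xs) ≡ count (Q? ∩? P?) xs
count-filter P? Q? [] = refl
count-filter P? Q? (x ∷ xs) with Q? x
... | no _ = count-filter P? Q? xs
... | yes _ with P? x
...   | yes _ = cong suc (count-filter P? Q? xs)
...   | no _  = count-filter P? Q? xs

length≡count+count∁ : (P? : Decidable P) → ∀ xs → length xs ≡ count P? xs + count (∁? P?) xs
length≡count+count∁ P? [] = refl
length≡count+count∁ P? (x ∷ xs) with P? x
... | yes _ = cong suc (length≡count+count∁ P? xs)
... | no _  = trans (cong suc (length≡count+count∁ P? xs)) (sym (+-suc _ _))

count≡count∩+count∩∁ : (P? : Decidable P) (Q? : Decidable Q) → ∀ xs →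
  count P? xs ≡ count (P? ∩? Q?) xs + count (P? ∩? ∁? Q?) xs
count≡count∩+count∩∁ P? Q? [] = refl
count≡count∩+count∩∁ P? Q? (x ∷ xs) with P? x | Q? x
... | yes _ | yes _ = cong suc (count≡count∩+count∩∁ P? Q? xs)
... | yes _ | no _  = trans (cong suc (count≡count∩+count∩∁ P? Q? xs)) (sym (+-suc _ _))
... | no _  | _     = count≡count∩+count∩∁ P? Q? xs

count-∩-const : (P? : Decidable P) {R : Set} (R? : Dec R) → ∀ xs →
  count (λ x → P? x ×-dec R?) xs ≡ indicator R? * count P? xs
count-∩-const P? (yes r) xs = trans (count-≐ _ P? proj₁ (_, r) xs) (sym (+-identityʳ _))
count-∩-const P? (no ¬r) xs = count-none _ (λ _ (_ , r) → ¬r r) xs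

-- Functions are only equal pointwise, so lists of them are compared as multisets over a setoid.
module Multiplicity (S : DecSetoid 0ℓ 0ℓ) where
  open DecSetoid S renaming (refl to ≈-refl; sym to ≈-sym; trans to ≈-trans)

  multiplicity : Carrier → List Carrier → ℕ
  multiplicity z = count (_≟ z)

  Enumeration : List Carrier → Set
  Enumeration xs = ∀ z → multiplicity z xs ≡ 1

  private
    count-middle : {P : Pred Carrier 0ℓ} (P? : Decidable P) → ∀ ys₁ y ys₂ →
      count P? (ys₁ ++ y ∷ ys₂) ≡ indicator (P? y) + count P? (ys₁ ++ ys₂)
    count-middle P? ys₁ y ys₂ = begin
      count P? (ys₁ ++ y ∷ ys₂)                         ≡⟨ count-++ P? ys₁ (y ∷ ys₂) ⟩
      count P? ys₁ + count P? (y ∷ ys₂)                 ≡⟨ cong (count P? ys₁ +_) (count-∷ P? y ys₂) ⟩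
      count P? ys₁ + (indicator (P? y) + count P? ys₂)  ≡⟨ x∙yz≈y∙xz (count P? ys₁) (indicator (P? y)) (count P? ys₂) ⟩
      indicator (P? y) + (count P? ys₁ + count P? ys₂)  ≡⟨ cong (indicator (P? y) +_) (count-++ P? ys₁ ys₂) ⟨
      indicator (P? y) + count P? (ys₁ ++ ys₂)          ∎
      where open ≡-Reasoning

    occurrence : ∀ z ys → 1 ≤ multiplicity z ys →
      Σ[ (ys₁ , y , ys₂) ∈ List Carrier × Carrier × List Carrier ] ys ≡ ys₁ ++ y ∷ ys₂ × y ≈ z
    occurrence z (y ∷ ys) h with y ≟ z
    ... | yes y≈z = ([] , y , ys) , refl , y≈z
    ... | no _ with occurrence z ys h
    ...   | (ys₁ , y′ , ys₂) , refl , y′≈z = (y ∷ ys₁ , y′ , ys₂) , refl , y′≈z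

    multiplicity-self : ∀ x xs → 1 ≤ multiplicity x (x ∷ xs)
    multiplicity-self x xs with x ≟ x
    ... | yes _ = s≤s z≤n
    ... | no x≉x = ⊥-elim (x≉x ≈-refl)

  count-cong-multiplicity : ∀ xs ys → (∀ z → multiplicity z xs ≡ multiplicity z ys) →
    {P : Pred Carrier 0ℓ} (P? : Decidable P) → P Respects _≈_ → count P? xs ≡ count P? ys
  count-cong-multiplicity [] [] _ P? _ = refl
  count-cong-multiplicity [] (y ∷ ys) same P? _
    with () ← ≤-trans (multiplicity-self y ys) (≤-reflexive (sym (same y)))
  count-cong-multiplicity (x ∷ xs) ys same P? resp
    with (ys₁ , y , ys₂) , refl , y≈x ← occurrence x ys (subst (1 ≤_) (same x) (multiplicity-self x xs)) = begin
      count P? (x ∷ xs)                          ≡⟨ count-∷ P? x xs ⟩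
      indicator (P? x) + count P? xs             ≡⟨ cong₂ _+_ (indicator-cong (resp (≈-sym y≈x)) (resp y≈x) (P? x) (P? y))
                                                              (count-cong-multiplicity xs (ys₁ ++ ys₂) same′ P? resp) ⟩
      indicator (P? y) + count P? (ys₁ ++ ys₂)   ≡⟨ count-middle P? ys₁ y ys₂ ⟨
      count P? (ys₁ ++ y ∷ ys₂)                  ∎
    where
      open ≡-Reasoning
      same′ : ∀ z → multiplicity z xs ≡ multiplicity z (ys₁ ++ ys₂)
      same′ z = +-cancelˡ-≡ (indicator (x ≟ z)) _ _ (begin
        indicator (x ≟ z) + multiplicity z xs
          ≡⟨ count-∷ (_≟ z) x xs ⟨
        multiplicity z (x ∷ xs)
          ≡⟨ same z ⟩
        multiplicity z (ys₁ ++ y ∷ ys₂)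
          ≡⟨ count-middle (_≟ z) ys₁ y ys₂ ⟩
        indicator (y ≟ z) + multiplicity z (ys₁ ++ ys₂)
          ≡⟨ cong (_+ _) (indicator-cong (≈-trans (≈-sym y≈x)) (≈-trans y≈x) (y ≟ z) (x ≟ z)) ⟩
        indicator (x ≟ z) + multiplicity z (ys₁ ++ ys₂)
          ∎)

  count-∘-bijection : ∀ {xs} → Enumeration xs →
    (f g : Carrier → Carrier) → Congruent _≈_ _≈_ f → Congruent _≈_ _≈_ g →
    (∀ x → f (g x) ≈ x) → (∀ x → g (f x) ≈ x) →
    {P : Pred Carrier 0ℓ} (P? : Decidable P) → P Respects _≈_ → count P? xs ≡ count (P? ∘ f) xs
  count-∘-bijection {xs} enum f g f-cong g-cong fg gf P? resp =
    trans (count-cong-multiplicity xs (map f xs) same P? resp) (count-map P? f xs)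
    where
      same : ∀ z → multiplicity z xs ≡ multiplicity z (map f xs)
      same z = begin
        multiplicity z xs          ≡⟨ enum z ⟩
        1                          ≡⟨ enum (g z) ⟨
        multiplicity (g z) xs      ≡⟨ count-≐ (_≟ g z) (λ x → f x ≟ z)
                                        (λ x≈gz → ≈-trans (f-cong x≈gz) (fg z))
                                        (λ fx≈z → ≈-trans (≈-sym (gf _)) (g-cong fx≈z)) xs ⟩
        count (λ x → f x ≟ z) xs   ≡⟨ count-map (_≟ z) f xs ⟨
        multiplicity z (map f xs)  ∎
        where open ≡-Reasoning

  count-split-at : ∀ {xs} → Enumeration xs → {P : Pred Carrier 0ℓ} (P? : Decidable P) → P Respects _≈_ →
    ∀ e → count P? xs ≡ indicator (P? e) + count (P? ∩? ∁? (_≟ e)) xs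
  count-split-at {xs} enum P? resp e = begin
    count P? xs                                  ≡⟨ count≡count∩+count∩∁ P? (_≟ e) xs ⟩
    count (P? ∩? (_≟ e)) xs + rest               ≡⟨ cong (_+ rest) (count-≐ (P? ∩? (_≟ e)) (λ x → (x ≟ e) ×-dec P? e)
                                                      (λ (p , x≈e) → x≈e , resp x≈e p)
                                                      (λ (x≈e , p) → resp (≈-sym x≈e) p , x≈e) xs) ⟩
    count (λ x → (x ≟ e) ×-dec P? e) xs + rest   ≡⟨ cong (_+ rest) (count-∩-const (_≟ e) (P? e) xs) ⟩
    indicator (P? e) * multiplicity e xs + rest  ≡⟨ cong (λ m → indicator (P? e) * m + rest) (enum e) ⟩
    indicator (P? e) * 1 + rest                  ≡⟨ cong (_+ rest) (*-identityʳ _) ⟩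
    indicator (P? e) + rest                      ∎
    where
      open ≡-Reasoning
      rest = count (P? ∩? ∁? (_≟ e)) xs

  count-split-at₂ : ∀ {xs} → Enumeration xs → {P : Pred Carrier 0ℓ} (P? : Decidable P) → P Respects _≈_ →
    ∀ {e₁ e₂} → ¬ e₂ ≈ e₁ →
    count P? xs ≡ indicator (P? e₁) + indicator (P? e₂) + count ((P? ∩? ∁? (_≟ e₁)) ∩? ∁? (_≟ e₂)) xs
  count-split-at₂ {xs} enum {P} P? resp {e₁} {e₂} e₂≉e₁ = begin
    count P? xs
      ≡⟨ count-split-at {xs} enum P? resp e₁ ⟩
    indicator (P? e₁) + count P₁? xs
      ≡⟨ cong (indicator (P? e₁) +_) (count-split-at {xs} enum P₁? resp₁ e₂) ⟩
    indicator (P? e₁) + (indicator (P₁? e₂) + rest)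
      ≡⟨ +-assoc (indicator (P? e₁)) _ _ ⟨
    indicator (P? e₁) + indicator (P₁? e₂) + rest
      ≡⟨ cong (λ m → indicator (P? e₁) + m + rest) (indicator-cong proj₁ (_, e₂≉e₁) (P₁? e₂) (P? e₂)) ⟩
    indicator (P? e₁) + indicator (P? e₂) + rest
      ∎
    where
      open ≡-Reasoning
      P₁? = P? ∩? ∁? (_≟ e₁)
      rest = count (P₁? ∩? ∁? (_≟ e₂)) xs
      resp₁ : (P ∩ ∁ (_≈ e₁)) Respects _≈_
      resp₁ x≈y (p , x≉e₁) = resp x≈y p , λ y≈e₁ → x≉e₁ (≈-trans x≈y y≈e₁)

_≟ₚ_ : ∀ {n} → DecidableEquality (Fin n × Fin n)
_≟ₚ_ = ×-≡-dec F._≟_ F._≟_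

module FinMultiplicity (n : ℕ) = Multiplicity (F.≡-decSetoid n)
module PairMultiplicity (n : ℕ) = Multiplicity (decSetoid (_≟ₚ_ {n}))

_≟ᶠ_ : ∀ {m n} → (f g : Fin m → Fin n) → Dec (f ≗ g)
f ≟ᶠ g = F.all? (λ x → f x F.≟ g x)

_⇨_ : ℕ → ℕ → DecSetoid 0ℓ 0ℓ
m ⇨ n = record
  { Carrier = Fin m → Fin n
  ; _≈_ = _≗_
  ; isDecEquivalence = record
    { isEquivalence = record
      { refl = λ _ → refl
      ; sym = λ f≗g x → sym (f≗g x)
      ; trans = λ f≗g g≗h x → trans (f≗g x) (g≗h x)
      }
    ; _≟_ = _≟ᶠ_
    }
  }

module FunMultiplicity (m n : ℕ) = Multiplicity (m ⇨ n)

pairs : ∀ n → List (Fin n × Fin n)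
pairs n = cartesianProduct (allFin n) (allFin n)

allFin-enumeration : ∀ n → FinMultiplicity.Enumeration n (allFin n)
allFin-enumeration (suc n) z = begin
  count (F._≟ z) (zero ∷ tabulate suc)
    ≡⟨ count-∷ (F._≟ z) zero (tabulate suc) ⟩
  indicator (zero F.≟ z) + count (F._≟ z) (tabulate suc)
    ≡⟨ cong (λ xs → indicator (zero F.≟ z) + count (F._≟ z) xs) (map-tabulate id suc) ⟨
  indicator (zero F.≟ z) + count (F._≟ z) (map suc (allFin n))
    ≡⟨ cong (indicator (zero F.≟ z) +_) (count-map (F._≟ z) suc (allFin n)) ⟩
  indicator (zero F.≟ z) + count (λ x → suc x F.≟ z) (allFin n)
    ≡⟨ head+tail z ⟩
  1 ∎
  where
    open ≡-Reasoning
    head+tail : ∀ z → indicator (zero F.≟ z) + count (λ x → suc x F.≟ z) (allFin n) ≡ 1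
    head+tail zero    = cong suc (count-none (λ x → suc x F.≟ zero) (λ _ ()) (allFin n))
    head+tail (suc z) = trans (count-≐ (λ x → suc x F.≟ suc z) (F._≟ z) F.suc-injective (cong suc) (allFin n))
                              (allFin-enumeration n z)

multiplicity-cartesianProduct : ∀ {n} (xs ys : List (Fin n)) p q →
  PairMultiplicity.multiplicity n (p , q) (cartesianProduct xs ys) ≡
  FinMultiplicity.multiplicity n p xs * FinMultiplicity.multiplicity n q ys
multiplicity-cartesianProduct [] ys p q = refl
multiplicity-cartesianProduct (x ∷ xs) ys p q = begin
  count (_≟ₚ (p , q)) (map (x ,_) ys ++ cartesianProduct xs ys)
    ≡⟨ count-++ (_≟ₚ (p , q)) (map (x ,_) ys) _ ⟩
  count (_≟ₚ (p , q)) (map (x ,_) ys) + count (_≟ₚ (p , q)) (cartesianProduct xs ys)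
    ≡⟨ cong₂ _+_ row (multiplicity-cartesianProduct xs ys p q) ⟩
  indicator (x F.≟ p) * count (F._≟ q) ys + count (F._≟ p) xs * count (F._≟ q) ys
    ≡⟨ *-distribʳ-+ (count (F._≟ q) ys) (indicator (x F.≟ p)) _ ⟨
  (indicator (x F.≟ p) + count (F._≟ p) xs) * count (F._≟ q) ys
    ≡⟨ cong (_* count (F._≟ q) ys) (count-∷ (F._≟ p) x xs) ⟨
  count (F._≟ p) (x ∷ xs) * count (F._≟ q) ys
    ∎
  where
    open ≡-Reasoning
    row : count (_≟ₚ (p , q)) (map (x ,_) ys) ≡ indicator (x F.≟ p) * count (F._≟ q) ys
    row = begin
      count (_≟ₚ (p , q)) (map (x ,_) ys)
        ≡⟨ count-map (_≟ₚ (p , q)) (x ,_) ys ⟩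
      count (λ y → (x , y) ≟ₚ (p , q)) ys
        ≡⟨ count-≐ (λ y → (x , y) ≟ₚ (p , q)) (λ y → (y F.≟ q) ×-dec (x F.≟ p))
             (λ { refl → refl , refl }) (λ { (refl , refl) → refl }) ys ⟩
      count (λ y → (y F.≟ q) ×-dec (x F.≟ p)) ys
        ≡⟨ count-∩-const (F._≟ q) (x F.≟ p) ys ⟩
      indicator (x F.≟ p) * count (F._≟ q) ys
        ∎

pairs-enumeration : ∀ n → PairMultiplicity.Enumeration n (pairs n)
pairs-enumeration n (p , q) = trans (multiplicity-cartesianProduct (allFin n) (allFin n) p q)
  (cong₂ _*_ (allFin-enumeration n p) (allFin-enumeration n q))

allFuns-enumeration : ∀ m n → FunMultiplicity.Enumeration m n (allFuns m n)
allFuns-enumeration zero n z with (λ ()) ≟ᶠ z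
... | yes _ = refl
... | no ≉z = ⊥-elim (≉z (λ ()))
allFuns-enumeration (suc m) n z =
  trans (count-concatMap (_≟ᶠ z) (_≟ᶠ (z ∘ suc)) (λ f → map (λ x → cons x f) (allFin n)) column (allFuns m n))
        (allFuns-enumeration m n (z ∘ suc))
  where
    open ≡-Reasoning
    column : ∀ f → count (_≟ᶠ z) (map (λ x → cons x f) (allFin n)) ≡ indicator (f ≟ᶠ (z ∘ suc))
    column f = begin
      count (_≟ᶠ z) (map (λ x → cons x f) (allFin n))
        ≡⟨ count-map (_≟ᶠ z) (λ x → cons x f) (allFin n) ⟩
      count (λ x → cons x f ≟ᶠ z) (allFin n)
        ≡⟨ count-≐ (λ x → cons x f ≟ᶠ z) (λ x → (x F.≟ z zero) ×-dec (f ≟ᶠ (z ∘ suc)))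
             (λ e → e zero , e ∘ suc) (λ { (e₀ , e) → λ { zero → e₀ ; (suc i) → e i } }) (allFin n) ⟩
      count (λ x → (x F.≟ z zero) ×-dec (f ≟ᶠ (z ∘ suc))) (allFin n)
        ≡⟨ count-∩-const (F._≟ z zero) (f ≟ᶠ (z ∘ suc)) (allFin n) ⟩
      indicator (f ≟ᶠ (z ∘ suc)) * count (F._≟ z zero) (allFin n)
        ≡⟨ cong (indicator (f ≟ᶠ (z ∘ suc)) *_) (allFin-enumeration n (z zero)) ⟩
      indicator (f ≟ᶠ (z ∘ suc)) * 1
        ≡⟨ *-identityʳ _ ⟩
      indicator (f ≟ᶠ (z ∘ suc))
        ∎

IsPerm-∘ : ∀ {n} {σ τ : Fin n → Fin n} → IsPerm σ → IsPerm τ → IsPerm (σ ∘ τ)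
IsPerm-∘ σ-inj τ-inj a b e = τ-inj a b (σ-inj _ _ e)

data Position {n} (i j : Fin n) : Fin n → Set where
  at-i : Position i j i
  at-j : Position i j j
  elsewhere : ∀ {k} → k ≢ i → k ≢ j → Position i j k

position : ∀ {n} (i j k : Fin n) → Position i j k
position i j k with k F.≟ i | k F.≟ j
... | yes refl | _ = at-i
... | no _ | yes refl = at-j
... | no k≢i | no k≢j = elsewhere k≢i k≢j

transpose-matchˡ : ∀ {n} (i j : Fin n) → transpose i j i ≡ j
transpose-matchˡ i j rewrite dec-true (i F.≟ i) refl = refl

transpose-matchʳ : ∀ {n} (i j : Fin n) → transpose i j j ≡ i
transpose-matchʳ i j with j F.≟ i
... | yes j≡i = j≡i
... | no _ rewrite dec-true (j F.≟ j) refl = refl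

transpose-fixes : ∀ {n} (i j : Fin n) {k} → k ≢ i → k ≢ j → transpose i j k ≡ k
transpose-fixes i j {k} k≢i k≢j rewrite dec-false (k F.≟ i) k≢i | dec-false (k F.≟ j) k≢j = refl

transpose-comm : ∀ {n} (i j : Fin n) → transpose i j ≗ transpose j i
transpose-comm i j k with position i j k
... | at-i = trans (transpose-matchˡ i j) (sym (transpose-matchʳ j i))
... | at-j = trans (transpose-matchʳ i j) (sym (transpose-matchˡ j i))
... | elsewhere k≢i k≢j = trans (transpose-fixes i j k≢i k≢j) (sym (transpose-fixes j i k≢j k≢i))

transpose-involutive : ∀ {n} (i j : Fin n) k → transpose i j (transpose i j k) ≡ k
transpose-involutive i j k = trans (cong (transpose i j) (transpose-comm i j k)) (transpose-inverse i j)

transpose-injective : ∀ {n} (i j : Fin n) → IsPerm (transpose i j)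
transpose-injective i j a b e =
  trans (sym (transpose-involutive i j a)) (trans (cong (transpose i j) e) (transpose-involutive i j b))

transpose-conjugate : ∀ {n} {i j k : Fin n} → i ≢ k → k ≢ j → i ≢ j →
  transpose i j ≗ transpose i k ∘ transpose k j ∘ transpose i k
transpose-conjugate {i = i} {j} {k} i≢k k≢j i≢j x = by-cases (x F.≟ i) (x F.≟ k) (x F.≟ j)
  where
  open ≡-Reasoning
  by-cases : Dec (x ≡ i) → Dec (x ≡ k) → Dec (x ≡ j) →
    transpose i j x ≡ transpose i k (transpose k j (transpose i k x))
  by-cases (yes refl) _ _ = begin
    transpose x j x                                    ≡⟨ transpose-matchˡ x j ⟩
    j                                                  ≡⟨ transpose-fixes x k (i≢j ∘ sym) (k≢j ∘ sym) ⟨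
    transpose x k j                                    ≡⟨ cong (transpose x k) (transpose-matchˡ k j) ⟨
    transpose x k (transpose k j k)                    ≡⟨ cong (transpose x k ∘ transpose k j) (transpose-matchˡ x k) ⟨
    transpose x k (transpose k j (transpose x k x))    ∎
  by-cases (no x≢i) (yes refl) _ = begin
    transpose i j x                                    ≡⟨ transpose-fixes i j x≢i k≢j ⟩
    x                                                  ≡⟨ transpose-matchˡ i x ⟨
    transpose i x i                                    ≡⟨ cong (transpose i x) (transpose-fixes x j i≢k i≢j) ⟨
    transpose i x (transpose x j i)                    ≡⟨ cong (transpose i x ∘ transpose x j) (transpose-matchʳ i x) ⟨
    transpose i x (transpose x j (transpose i x x))    ∎
  by-cases (no x≢i) (no x≢k) (yes refl) = begin
    transpose i x x                                    ≡⟨ transpose-matchʳ i x ⟩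
    i                                                  ≡⟨ transpose-matchʳ i k ⟨
    transpose i k k                                    ≡⟨ cong (transpose i k) (transpose-matchʳ k x) ⟨
    transpose i k (transpose k x x)                    ≡⟨ cong (transpose i k ∘ transpose k x) (transpose-fixes i k x≢i x≢k) ⟨
    transpose i k (transpose k x (transpose i k x))    ∎
  by-cases (no x≢i) (no x≢k) (no x≢j) = begin
    transpose i j x                                    ≡⟨ transpose-fixes i j x≢i x≢j ⟩
    x                                                  ≡⟨ transpose-fixes i k x≢i x≢k ⟨
    transpose i k x                                    ≡⟨ cong (transpose i k) (transpose-fixes k j x≢k x≢j) ⟨
    transpose i k (transpose k j x)                    ≡⟨ cong (transpose i k ∘ transpose k j) (transpose-fixes i k x≢i x≢k) ⟨
    transpose i k (transpose k j (transpose i k x))    ∎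

adjacent⇒< : ∀ {n} {i j : Fin n} → toℕ j ≡ suc (toℕ i) → i <ᶠ j
adjacent⇒< {i = i} i⋖j = subst (toℕ i <_) (sym i⋖j) (n<1+n (toℕ i))

transpose-adjacent-< : ∀ {n} {i j p q : Fin n} → toℕ j ≡ suc (toℕ i) →
  (p , q) ≢ (i , j) → (p , q) ≢ (j , i) → p <ᶠ q → transpose i j p <ᶠ transpose i j q
transpose-adjacent-< {i = i} {j} {p} {q} i⋖j ≢ij ≢ji p<q with position i j p | position i j q
... | at-i | at-i = ⊥-elim (<-irrefl refl p<q)
... | at-i | at-j = ⊥-elim (≢ij refl)
... | at-i | elsewhere q≢i q≢j = subst₂ _<ᶠ_ (sym (transpose-matchˡ i j)) (sym (transpose-fixes i j q≢i q≢j))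
                                   (≤∧≢⇒< (subst (_≤ toℕ q) (sym i⋖j) p<q) (q≢j ∘ F.toℕ-injective ∘ sym))
... | at-j | at-i = ⊥-elim (≢ji refl)
... | at-j | at-j = ⊥-elim (<-irrefl refl p<q)
... | at-j | elsewhere q≢i q≢j = subst₂ _<ᶠ_ (sym (transpose-matchʳ i j)) (sym (transpose-fixes i j q≢i q≢j))
                                   (<-trans (adjacent⇒< i⋖j) p<q)
... | elsewhere p≢i p≢j | at-i = subst₂ _<ᶠ_ (sym (transpose-fixes i j p≢i p≢j)) (sym (transpose-matchˡ i j))
                                   (<-trans p<q (adjacent⇒< i⋖j))
... | elsewhere p≢i p≢j | at-j = subst₂ _<ᶠ_ (sym (transpose-fixes i j p≢i p≢j)) (sym (transpose-matchʳ i j))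
                                   (≤∧≢⇒< (≤-pred (subst (toℕ p <_) i⋖j p<q)) (p≢i ∘ F.toℕ-injective))
... | elsewhere p≢i p≢j | elsewhere q≢i q≢j =
  subst₂ _<ᶠ_ (sym (transpose-fixes i j p≢i p≢j)) (sym (transpose-fixes i j q≢i q≢j)) p<q

transpose-adjacent-<⁻ : ∀ {n} {i j p q : Fin n} → toℕ j ≡ suc (toℕ i) →
  (p , q) ≢ (i , j) → (p , q) ≢ (j , i) → transpose i j p <ᶠ transpose i j q → p <ᶠ q
transpose-adjacent-<⁻ {i = i} {j} {p} {q} i⋖j ≢ij ≢ji sp<sq =
  subst₂ _<ᶠ_ (transpose-involutive i j p) (transpose-involutive i j q) (transpose-adjacent-< i⋖j s≢ij s≢ji sp<sq)
  where
    s = transpose i j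
    back : ∀ {a b} → (s p , s q) ≡ (a , b) → (p , q) ≡ (s a , s b)
    back refl = sym (cong₂ _,_ (transpose-involutive i j p) (transpose-involutive i j q))
    s≢ij : (s p , s q) ≢ (i , j)
    s≢ij e = ≢ji (trans (back e) (cong₂ _,_ (transpose-matchˡ i j) (transpose-matchʳ i j)))
    s≢ji : (s p , s q) ≢ (j , i)
    s≢ji e = ≢ij (trans (back e) (cong₂ _,_ (transpose-matchʳ i j) (transpose-matchˡ i j)))

-- Chosen so that inversions σ ≡ count (inversion? σ) (pairs n) holds by definition.
Inversion : ∀ {n} → (Fin n → Fin n) → Pred (Fin n × Fin n) 0ℓ
Inversion σ r = proj₁ r <ᶠ proj₂ r × σ (proj₂ r) <ᶠ σ (proj₁ r)

inversion? : ∀ {n} (σ : Fin n → Fin n) → Decidable (Inversion σ)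
inversion? σ r = (proj₁ r F.<? proj₂ r) ×-dec (σ (proj₂ r) F.<? σ (proj₁ r))

inversions-cong : ∀ {n} {σ τ : Fin n → Fin n} → σ ≗ τ → inversions σ ≡ inversions τ
inversions-cong {n} {σ} {τ} σ≗τ = count-≐ (inversion? σ) (inversion? τ)
  (λ {(p , q)} (p<q , inv) → p<q , subst₂ _<ᶠ_ (σ≗τ q) (σ≗τ p) inv)
  (λ {(p , q)} (p<q , inv) → p<q , subst₂ _<ᶠ_ (sym (σ≗τ q)) (sym (σ≗τ p)) inv) (pairs n)

module _ {n} {i j : Fin n} (i⋖j : toℕ j ≡ suc (toℕ i)) (α : Fin n → Fin n) where
  private
    open PairMultiplicity n
    open ≡-Reasoning

    s = transpose i j

    s² : Fin n × Fin n → Fin n × Fin n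
    s² (p , q) = s p , s q

    s²-involutive : ∀ r → s² (s² r) ≡ r
    s²-involutive (p , q) = cong₂ _,_ (transpose-involutive i j p) (transpose-involutive i j q)

    i<j : i <ᶠ j
    i<j = adjacent⇒< i⋖j

    sj<si : s j <ᶠ s i
    sj<si = subst₂ _<ᶠ_ (sym (transpose-matchʳ i j)) (sym (transpose-matchˡ i j)) i<j

    ji≢ij : (j , i) ≢ (i , j)
    ji≢ij e = <-irrefl (cong (toℕ ∘ proj₂) e) i<j

    αss : ∀ k → α (s (s k)) ≡ α k
    αss k = cong α (transpose-involutive i j k)

    inversionsAway : (Fin n × Fin n → Fin n × Fin n) → (Fin n → Fin n) → ℕ
    inversionsAway f σ = count (((inversion? σ ∘ f) ∩? ∁? (_≟ₚ (i , j))) ∩? ∁? (_≟ₚ (j , i))) (pairs n)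

    rest : ℕ
    rest = inversionsAway id α

    -- Reindexed by s, the inversions of α ∘ s are the pairs (p , q) with s p < s q and α q < α p;
    -- away from (i , j) and (j , i) the transposition s preserves the order, so these are inversions of α.
    inversionsAway-∘ : inversionsAway s² (α ∘ s) ≡ rest
    inversionsAway-∘ = count-≐ _ _
      (λ {(p , q)} (((sp<sq , inv) , ≢ij) , ≢ji) →
         ((transpose-adjacent-<⁻ i⋖j ≢ij ≢ji sp<sq , subst₂ _<ᶠ_ (αss q) (αss p) inv) , ≢ij) , ≢ji)
      (λ {(p , q)} (((p<q , inv) , ≢ij) , ≢ji) →
         ((transpose-adjacent-< i⋖j ≢ij ≢ji p<q , subst₂ _<ᶠ_ (sym (αss q)) (sym (αss p)) inv) , ≢ij) , ≢ji)
      (pairs n)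

    inversions-∘-split : inversions (α ∘ s) ≡ indicator (α i F.<? α j) + rest
    inversions-∘-split = begin
      inversions (α ∘ s)
        ≡⟨ count-∘-bijection {pairs n} (pairs-enumeration n) s² s² (cong s²) (cong s²) s²-involutive s²-involutive
             (inversion? (α ∘ s)) (λ { refl inv → inv }) ⟩
      count (inversion? (α ∘ s) ∘ s²) (pairs n)
        ≡⟨ count-split-at₂ {pairs n} (pairs-enumeration n) (inversion? (α ∘ s) ∘ s²) (λ { refl inv → inv }) ji≢ij ⟩
      indicator (inversion? (α ∘ s) (s i , s j)) + indicator (inversion? (α ∘ s) (s j , s i)) + inversionsAway s² (α ∘ s)
        ≡⟨ cong₂ (λ a b → a + b + inversionsAway s² (α ∘ s))
             (indicator-no (λ (si<sj , _) → <-asym si<sj sj<si) (inversion? (α ∘ s) (s i , s j)))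
             (indicator-cong (λ (_ , inv) → subst₂ _<ᶠ_ (αss i) (αss j) inv)
                             (λ αi<αj → sj<si , subst₂ _<ᶠ_ (sym (αss i)) (sym (αss j)) αi<αj)
                             (inversion? (α ∘ s) (s j , s i)) (α i F.<? α j)) ⟩
      indicator (α i F.<? α j) + inversionsAway s² (α ∘ s)
        ≡⟨ cong (indicator (α i F.<? α j) +_) inversionsAway-∘ ⟩
      indicator (α i F.<? α j) + rest
        ∎

    inversions-split : inversions α ≡ indicator (α j F.<? α i) + rest
    inversions-split = begin
      inversions α
        ≡⟨ count-split-at₂ {pairs n} (pairs-enumeration n) (inversion? α) (λ { refl inv → inv }) ji≢ij ⟩
      indicator (inversion? α (i , j)) + indicator (inversion? α (j , i)) + rest
        ≡⟨ cong₂ (λ a b → a + b + rest)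
             (indicator-cong proj₂ (i<j ,_) (inversion? α (i , j)) (α j F.<? α i))
             (indicator-no (λ (j<i , _) → <-asym j<i i<j) (inversion? α (j , i))) ⟩
      indicator (α j F.<? α i) + 0 + rest
        ≡⟨ cong (_+ rest) (+-identityʳ _) ⟩
      indicator (α j F.<? α i) + rest
        ∎

  inversions-∘-adjacent : IsPerm α →
    inversions (α ∘ transpose i j) ≡ suc (inversions α) ⊎ inversions α ≡ suc (inversions (α ∘ transpose i j))
  inversions-∘-adjacent α-inj with F.<-cmp (α i) (α j)
  ... | tri< αi<αj _ _ = inj₁ (begin
    inversions (α ∘ s)                     ≡⟨ inversions-∘-split ⟩
    indicator (α i F.<? α j) + rest        ≡⟨ cong (_+ rest) (indicator-yes αi<αj _) ⟩
    suc (0 + rest)                         ≡⟨ cong (λ a → suc (a + rest)) (indicator-no (<-asym αi<αj) _) ⟨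
    suc (indicator (α j F.<? α i) + rest)  ≡⟨ cong suc inversions-split ⟨
    suc (inversions α)                     ∎)
  ... | tri> _ _ αj<αi = inj₂ (begin
    inversions α                           ≡⟨ inversions-split ⟩
    indicator (α j F.<? α i) + rest        ≡⟨ cong (_+ rest) (indicator-yes αj<αi _) ⟩
    suc (0 + rest)                         ≡⟨ cong (λ a → suc (a + rest)) (indicator-no (<-asym αj<αi) _) ⟨
    suc (indicator (α i F.<? α j) + rest)  ≡⟨ cong suc inversions-∘-split ⟨
    suc (inversions (α ∘ s))               ∎)
  ... | tri≈ _ αi≡αj _ = ⊥-elim (<-irrefl (cong toℕ (α-inj i j αi≡αj)) i<j)

parity-suc : ∀ m → parity (suc m) ≡ parity m ⁻¹
parity-suc m = sym (⁻¹-selfInverse (suc-homo-⁻¹ m))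

%2≡1⇒parity≡1ℙ : ∀ m → m % 2 ≡ 1 → parity m ≡ 1ℙ
%2≡1⇒parity≡1ℙ 1             _ = refl
%2≡1⇒parity≡1ℙ (suc (suc m)) e = %2≡1⇒parity≡1ℙ m e

parity≡1ℙ⇒%2≡1 : ∀ m → parity m ≡ 1ℙ → m % 2 ≡ 1
parity≡1ℙ⇒%2≡1 1             _ = refl
parity≡1ℙ⇒%2≡1 (suc (suc m)) e = parity≡1ℙ⇒%2≡1 m e

pred-of-even⇒parity≡1ℙ : ∀ r → ¬ (suc r % 2 ≡ 1) → parity r ≡ 1ℙ
pred-of-even⇒parity≡1ℙ r 1+r-even with parity r in eq
... | 1ℙ = refl
... | 0ℙ = ⊥-elim (1+r-even (parity≡1ℙ⇒%2≡1 (suc r) (trans (parity-suc r) (cong _⁻¹ eq))))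

sign : ∀ {n} → (Fin n → Fin n) → Parity
sign σ = parity (inversions σ)

sign-∘-adjacent : ∀ {n} {i j : Fin n} {α : Fin n → Fin n} → IsPerm α → toℕ j ≡ suc (toℕ i) →
  sign (α ∘ transpose i j) ≡ sign α ⁻¹
sign-∘-adjacent {α = α} α-inj i⋖j with inversions-∘-adjacent i⋖j α α-inj
... | inj₁ e = trans (cong parity e) (parity-suc (inversions α))
... | inj₂ e = sym (⁻¹-selfInverse (sym (trans (cong parity e) (parity-suc (inversions (α ∘ _))))))

sign-∘-transpose-at : ∀ d {n} {i j : Fin n} {α : Fin n → Fin n} → IsPerm α → toℕ j ≡ suc (d + toℕ i) →
  sign (α ∘ transpose i j) ≡ sign α ⁻¹
sign-∘-transpose-at zero α-inj j≡1+i = sign-∘-adjacent α-inj j≡1+i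
sign-∘-transpose-at (suc d) {n} {i} {j} {α} α-inj gap = begin
  sign (α ∘ transpose i j)
    ≡⟨ cong parity (inversions-cong (cong α ∘ transpose-conjugate i≢k k≢j i≢j)) ⟩
  sign (α ∘ transpose i k ∘ transpose k j ∘ transpose i k)
    ≡⟨ sign-∘-adjacent (IsPerm-∘ (IsPerm-∘ α-inj (transpose-injective i k)) (transpose-injective k j)) i⋖k ⟩
  sign (α ∘ transpose i k ∘ transpose k j) ⁻¹
    ≡⟨ cong _⁻¹ (sign-∘-transpose-at d (IsPerm-∘ α-inj (transpose-injective i k)) gap′) ⟩
  sign (α ∘ transpose i k) ⁻¹ ⁻¹
    ≡⟨ ⁻¹-involutive _ ⟩
  sign (α ∘ transpose i k)
    ≡⟨ sign-∘-adjacent α-inj i⋖k ⟩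
  sign α ⁻¹
    ∎
  where
    open ≡-Reasoning
    1+i<j : suc (toℕ i) < toℕ j
    1+i<j = subst (suc (toℕ i) <_) (sym gap) (s≤s (s≤s (m≤n+m (toℕ i) d)))
    k : Fin n
    k = fromℕ< (<-trans 1+i<j (F.toℕ<n j))
    i⋖k : toℕ k ≡ suc (toℕ i)
    i⋖k = F.toℕ-fromℕ< _
    gap′ : toℕ j ≡ suc (d + toℕ k)
    gap′ = trans gap (cong suc (sym (trans (cong (d +_) i⋖k) (+-suc d (toℕ i)))))
    i≢k : i ≢ k
    i≢k i≡k = <-irrefl (trans (cong toℕ i≡k) i⋖k) (n<1+n (toℕ i))
    k≢j : k ≢ j
    k≢j k≡j = <-irrefl (trans (sym i⋖k) (cong toℕ k≡j)) 1+i<j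
    i≢j : i ≢ j
    i≢j i≡j = <-asym (subst (λ x → suc (toℕ i) < toℕ x) (sym i≡j) 1+i<j) (n<1+n (toℕ i))

sign-∘-transpose : ∀ {n} {i j : Fin n} {α : Fin n → Fin n} → IsPerm α → i ≢ j →
  sign (α ∘ transpose i j) ≡ sign α ⁻¹
sign-∘-transpose {i = i} {j} {α} α-inj i≢j with <-cmp (toℕ i) (toℕ j)
... | tri< i<j _ _ = sign-∘-transpose-at (toℕ j ∸ suc (toℕ i)) α-inj (sym (trans (sym (+-suc _ _)) (m∸n+n≡m i<j)))
... | tri≈ _ i≡j _ = ⊥-elim (i≢j (F.toℕ-injective i≡j))
... | tri> _ _ j<i = trans (cong parity (inversions-cong (cong α ∘ transpose-comm i j)))
                           (sign-∘-transpose-at (toℕ i ∸ suc (toℕ j)) α-inj (sym (trans (sym (+-suc _ _)) (m∸n+n≡m j<i))))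

transpositionProduct : ∀ {n} → List (Fin n × Fin n) → Fin n → Fin n
transpositionProduct []             = id
transpositionProduct ((i , j) ∷ ts) = transpose i j ∘ transpositionProduct ts

transpositionProduct⁻¹ : ∀ {n} → List (Fin n × Fin n) → Fin n → Fin n
transpositionProduct⁻¹ []             = id
transpositionProduct⁻¹ ((i , j) ∷ ts) = transpositionProduct⁻¹ ts ∘ transpose i j

transpositionProduct-inverseˡ : ∀ {n} (ts : List (Fin n × Fin n)) x → transpositionProduct⁻¹ ts (transpositionProduct ts x) ≡ x
transpositionProduct-inverseˡ []             x = refl
transpositionProduct-inverseˡ ((i , j) ∷ ts) x =
  trans (cong (transpositionProduct⁻¹ ts) (transpose-involutive i j _)) (transpositionProduct-inverseˡ ts x)

transpositionProduct-inverseʳ : ∀ {n} (ts : List (Fin n × Fin n)) x → transpositionProduct ts (transpositionProduct⁻¹ ts x) ≡ x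
transpositionProduct-inverseʳ []             x = refl
transpositionProduct-inverseʳ ((i , j) ∷ ts) x =
  trans (cong (transpose i j) (transpositionProduct-inverseʳ ts (transpose i j x))) (transpose-involutive i j x)

sign-∘-transpositionProduct : ∀ {n} {ts : List (Fin n × Fin n)} {α : Fin n → Fin n} →
  All (λ (i , j) → i ≢ j) ts → IsPerm α → sign (α ∘ transpositionProduct ts) ≡ parity (length ts) ℙ.+ sign α
sign-∘-transpositionProduct [] α-inj = refl
sign-∘-transpositionProduct {ts = (i , j) ∷ ts} {α} (i≢j ∷ distinct) α-inj = begin
  sign (α ∘ transpose i j ∘ transpositionProduct ts)  ≡⟨ sign-∘-transpositionProduct distinct
                                                           (IsPerm-∘ α-inj (transpose-injective i j)) ⟩
  parity (length ts) ℙ.+ sign (α ∘ transpose i j)     ≡⟨ cong (parity (length ts) ℙ.+_) (sign-∘-transpose α-inj i≢j) ⟩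
  parity (length ts) ℙ.+ sign α ⁻¹                    ≡⟨ +-⁻¹-swap (parity (length ts)) (sign α) ⟩
  parity (length ts) ⁻¹ ℙ.+ sign α                    ≡⟨ cong (ℙ._+ sign α) (parity-suc (length ts)) ⟨
  parity (suc (length ts)) ℙ.+ sign α                 ∎
  where
    open ≡-Reasoning
    +-⁻¹-swap : ∀ p q → p ℙ.+ q ⁻¹ ≡ p ⁻¹ ℙ.+ q
    +-⁻¹-swap 0ℙ q = refl
    +-⁻¹-swap 1ℙ q = ⁻¹-involutive q

record OddCommutingPermutation {n} (β : Fin n → Fin n) : Set where
  field
    transpositions : List (Fin n × Fin n)
    distinct : All (λ (i , j) → i ≢ j) transpositions
    odd : parity (length transpositions) ≡ 1ℙ
    commutes : ∀ x → transpositionProduct transpositions (β x) ≡ β (transpositionProduct transpositions x)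

H-cong : ∀ {n} {σ σ′ τ τ′ : Fin n → Fin n} → σ ≗ σ′ → τ ≗ τ′ → H σ τ ≡ H σ′ τ′
H-cong {n} σ≗σ′ τ≗τ′ = count-≐ _ _
  (λ σa≢τa e → σa≢τa (trans (σ≗σ′ _) (trans e (sym (τ≗τ′ _)))))
  (λ σ′a≢τ′a e → σ′a≢τ′a (trans (sym (σ≗σ′ _)) (trans e (τ≗τ′ _)))) (allFin n)

H-∘-commuting : ∀ {n} (β α τ τ⁻¹ : Fin n → Fin n) →
  (∀ x → τ (τ⁻¹ x) ≡ x) → (∀ x → τ⁻¹ (τ x) ≡ x) →
  (∀ x → τ (β x) ≡ β (τ x)) → H (α ∘ τ ∘ β) (β ∘ α ∘ τ) ≡ H (α ∘ β) (β ∘ α)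
H-∘-commuting {n} β α τ τ⁻¹ inverseʳ inverseˡ commutes = begin
  H (α ∘ τ ∘ β) (β ∘ α ∘ τ)                    ≡⟨ H-cong (cong α ∘ commutes) (λ _ → refl) ⟩
  count (defect? ∘ τ) (allFin n)               ≡⟨ count-∘-bijection {allFin n} (allFin-enumeration n) τ τ⁻¹ (cong τ) (cong τ⁻¹)
                                                    inverseʳ inverseˡ defect? (λ { refl d → d }) ⟨
  H (α ∘ β) (β ∘ α)                            ∎
  where
    open ≡-Reasoning
    open FinMultiplicity n
    defect? : ∀ a → Dec (α (β a) ≢ β (α a))
    defect? a = ¬? (α (β a) F.≟ β (α a))

count-C : ∀ {n} k (β : Fin n → Fin n) {P : Pred (Fin n → Fin n) 0ℓ} (P? : Decidable P) →
  count P? (C k β) ≡ count (isPerm? ∩? (λ α → H (α ∘ β) (β ∘ α) ≟ℕ k) ∩? P?) (allFuns n n)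
count-C {n} k β P? = trans (count-filter P? inC? (Sym n)) (count-filter (inC? ∩? P?) isPerm? (allFuns n n))
  where
    inC? : ∀ α → Dec (H (α ∘ β) (β ∘ α) ≡ k)
    inC? α = H (α ∘ β) (β ∘ α) ≟ℕ k

module _ {n} {β : Fin n → Fin n} (τ* : OddCommutingPermutation β) where
  open OddCommutingPermutation τ*

  private
    τ τ⁻¹ : Fin n → Fin n
    τ = transpositionProduct transpositions
    τ⁻¹ = transpositionProduct⁻¹ transpositions

    τ-inverseˡ : ∀ x → τ⁻¹ (τ x) ≡ x
    τ-inverseˡ = transpositionProduct-inverseˡ transpositions

    τ-inverseʳ : ∀ x → τ (τ⁻¹ x) ≡ x
    τ-inverseʳ = transpositionProduct-inverseʳ transpositions

    τ-injective : IsPerm τ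
    τ-injective a b e = trans (sym (τ-inverseˡ a)) (trans (cong τ⁻¹ e) (τ-inverseˡ b))

    IsPerm-∘-odd⁻ : ∀ {α} → IsPerm (α ∘ τ) → IsPerm α
    IsPerm-∘-odd⁻ {α} α∘τ-inj a b e = begin
      a          ≡⟨ τ-inverseʳ a ⟨
      τ (τ⁻¹ a)  ≡⟨ cong τ (α∘τ-inj _ _ (trans (cong α (τ-inverseʳ a)) (trans e (cong α (sym (τ-inverseʳ b)))))) ⟩
      τ (τ⁻¹ b)  ≡⟨ τ-inverseʳ b ⟩
      b          ∎
      where open ≡-Reasoning

  sign-∘-odd : ∀ {α} → IsPerm α → sign (α ∘ τ) ≡ sign α ⁻¹
  sign-∘-odd {α} α-inj = trans (sign-∘-transpositionProduct distinct α-inj) (cong (ℙ._+ sign α) odd)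

  IsOdd⇒¬IsOdd-∘-odd : ∀ {α} → IsPerm α → IsOdd α → ¬ IsOdd (α ∘ τ)
  IsOdd⇒¬IsOdd-∘-odd {α} α-inj α-odd α∘τ-odd = p≢p⁻¹ 1ℙ (begin
    1ℙ            ≡⟨ %2≡1⇒parity≡1ℙ (inversions (α ∘ τ)) α∘τ-odd ⟨
    sign (α ∘ τ)  ≡⟨ sign-∘-odd α-inj ⟩
    sign α ⁻¹     ≡⟨ cong _⁻¹ (%2≡1⇒parity≡1ℙ (inversions α) α-odd) ⟩
    1ℙ ⁻¹         ∎)
    where open ≡-Reasoning

  ¬IsOdd-∘-odd⇒IsOdd : ∀ {α} → IsPerm α → ¬ IsOdd (α ∘ τ) → IsOdd α
  ¬IsOdd-∘-odd⇒IsOdd {α} α-inj α∘τ-even = parity≡1ℙ⇒%2≡1 (inversions α) (by-cases (sign α) refl)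
    where
      by-cases : ∀ p → sign α ≡ p → sign α ≡ 1ℙ
      by-cases 1ℙ e = e
      by-cases 0ℙ e =
        ⊥-elim (α∘τ-even (parity≡1ℙ⇒%2≡1 (inversions (α ∘ τ)) (trans (sign-∘-odd α-inj) (cong _⁻¹ e))))

  H-∘-odd : ∀ α → H (α ∘ τ ∘ β) (β ∘ α ∘ τ) ≡ H (α ∘ β) (β ∘ α)
  H-∘-odd α = H-∘-commuting β α τ τ⁻¹ τ-inverseʳ τ-inverseˡ commutes

  count-odd≡count-even : ∀ k → count isOdd? (C k β) ≡ count (∁? isOdd?) (C k β)
  count-odd≡count-even k = begin
    count isOdd? (C k β)
      ≡⟨ count-C k β isOdd? ⟩
    count (isPerm? ∩? inC? ∩? isOdd?) (allFuns n n)
      ≡⟨ count-≐ _ _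
           (λ (α-inj , α∈C , α-odd) →
              IsPerm-∘ α-inj τ-injective , trans (H-∘-odd _) α∈C , IsOdd⇒¬IsOdd-∘-odd α-inj α-odd)
           (λ (α∘τ-inj , α∘τ∈C , α∘τ-even) →
              IsPerm-∘-odd⁻ α∘τ-inj , trans (sym (H-∘-odd _)) α∘τ∈C , ¬IsOdd-∘-odd⇒IsOdd (IsPerm-∘-odd⁻ α∘τ-inj) α∘τ-even)
           (allFuns n n) ⟩
    count (Even? ∘ (_∘ τ)) (allFuns n n)
      ≡⟨ count-∘-bijection {allFuns n n} (allFuns-enumeration n n) (_∘ τ) (_∘ τ⁻¹) (_∘ τ) (_∘ τ⁻¹)
           (λ α → cong α ∘ τ-inverseˡ) (λ α → cong α ∘ τ-inverseʳ) Even? Even-resp ⟨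
    count Even? (allFuns n n)
      ≡⟨ count-C k β (∁? isOdd?) ⟨
    count (∁? isOdd?) (C k β)
      ∎
    where
      open ≡-Reasoning
      open FunMultiplicity n n
      inC? : ∀ α → Dec (H (α ∘ β) (β ∘ α) ≡ k)
      inC? α = H (α ∘ β) (β ∘ α) ≟ℕ k
      Even? = isPerm? ∩? inC? ∩? ∁? isOdd?
      Even-resp : (IsPerm ∩ (λ α → H (α ∘ β) (β ∘ α) ≡ k) ∩ ∁ IsOdd) Respects _≗_
      Even-resp {α} {α′} α≗α′ (α-inj , α∈C , α-even) =
        (λ a b e → α-inj a b (trans (α≗α′ a) (trans e (sym (α≗α′ b))))) ,
        trans (sym (H-cong (α≗α′ ∘ β) (cong β ∘ α≗α′))) α∈C ,
        λ α′-odd → α-even (subst (λ m → m % 2 ≡ 1) (sym (inversions-cong α≗α′)) α′-odd)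

  half-of-C-odd : ∀ k → 2 * count isOdd? (C k β) ≡ length (C k β)
  half-of-C-odd k = begin
    2 * count isOdd? (C k β)                         ≡⟨ cong (count isOdd? (C k β) +_) (+-identityʳ _) ⟩
    count isOdd? (C k β) + count isOdd? (C k β)      ≡⟨ cong (count isOdd? (C k β) +_) (count-odd≡count-even k) ⟩
    count isOdd? (C k β) + count (∁? isOdd?) (C k β) ≡⟨ length≡count+count∁ isOdd? (C k β) ⟨
    length (C k β)                                   ∎
    where open ≡-Reasoning

least-positive : {P : ℕ → Set} → (∀ m → Dec (P m)) → ∀ {d} → 1 ≤ d → P d →
  Σ[ m ∈ ℕ ] 1 ≤ m × P m × (∀ j → 1 ≤ j → j < m → ¬ P j)
least-positive {P} P? {d} 1≤d Pd with search d
  where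
    search : ∀ K → (∀ j → 1 ≤ j → j ≤ K → ¬ P j) ⊎
                   Σ[ m ∈ ℕ ] 1 ≤ m × P m × (∀ j → 1 ≤ j → j < m → ¬ P j)
    search zero = inj₁ λ { _ () z≤n }
    search (suc K) with search K
    ... | inj₂ found = inj₂ found
    ... | inj₁ none with P? (suc K)
    ...   | yes P[1+K] = inj₂ (suc K , s≤s z≤n , P[1+K] , λ j 1≤j j<1+K → none j 1≤j (≤-pred j<1+K))
    ...   | no ¬P[1+K] = inj₁ λ j 1≤j j≤1+K → case m≤n⇒m<n∨m≡n j≤1+K of λ
                           { (inj₁ j<1+K) → none j 1≤j (≤-pred j<1+K)
                           ; (inj₂ refl) → ¬P[1+K] }
... | inj₁ none = ⊥-elim (none d 1≤d ≤-refl Pd)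
... | inj₂ found = found

module _ {n} (β : Fin n → Fin n) where

  iter-+ : ∀ i j a → iter β (i + j) a ≡ iter β i (iter β j a)
  iter-+ zero    j a = refl
  iter-+ (suc i) j a = cong β (iter-+ i j a)

  module _ (β-inj : IsPerm β) where

    iter-injective : ∀ j {a b} → iter β j a ≡ iter β j b → a ≡ b
    iter-injective zero    e = e
    iter-injective (suc j) e = iter-injective j (β-inj _ _ e)

    iter-periodic : ∀ a → Σ[ d ∈ ℕ ] 1 ≤ d × iter β d a ≡ a
    iter-periodic a with (i , j , i<j , e) ← F.pigeonhole (n<1+n n) (λ (i : Fin (suc n)) → iter β (toℕ i) a) =
      toℕ j ∸ toℕ i , m<n⇒0<n∸m i<j , iter-injective (toℕ i) (begin
        iter β (toℕ i) (iter β (toℕ j ∸ toℕ i) a) ≡⟨ iter-+ (toℕ i) _ a ⟨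
        iter β (toℕ i + (toℕ j ∸ toℕ i)) a        ≡⟨ cong (λ m → iter β m a) (m+[n∸m]≡n (<⇒≤ i<j)) ⟩
        iter β (toℕ j) a                          ≡⟨ e ⟨
        iter β (toℕ i) a                          ∎)
      where open ≡-Reasoning

    cycleLength : ∀ a → Σ ℕ (IsCycleLen β a)
    cycleLength a with (d , 1≤d , βᵈa≡a) ← iter-periodic a =
      least-positive (λ m → iter β m a F.≟ a) 1≤d βᵈa≡a

  IsCycleLen-unique : ∀ {a m m′} → IsCycleLen β a m → IsCycleLen β a m′ → m ≡ m′
  IsCycleLen-unique {m = m} {m′} (1≤m , βᵐa≡a , least) (1≤m′ , βᵐ′a≡a , least′) with <-cmp m m′
  ... | tri< m<m′ _ _ = ⊥-elim (least′ m 1≤m m<m′ βᵐa≡a)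
  ... | tri≈ _ m≡m′ _ = m≡m′
  ... | tri> _ _ m′<m = ⊥-elim (least m′ 1≤m′ m′<m βᵐ′a≡a)

InOrbit : ∀ {n} → (Fin n → Fin n) → Fin n → Fin n → Set
InOrbit β a z = ∃[ j ] iter β j a ≡ z

module Orbit {n} {β : Fin n → Fin n} (β-inj : IsPerm β) {a : Fin n} {r : ℕ} (cyc : IsCycleLen β a (suc r)) where

  orbit : ℕ → Fin n
  orbit j = iter β j a

  orbit-+-multiple : ∀ q j → orbit (j + q * suc r) ≡ orbit j
  orbit-+-multiple zero    j = cong orbit (+-identityʳ j)
  orbit-+-multiple (suc q) j = begin
    orbit (j + (suc r + q * suc r))  ≡⟨ cong orbit (+-assoc j (suc r) _) ⟨
    orbit (j + suc r + q * suc r)    ≡⟨ orbit-+-multiple q (j + suc r) ⟩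
    orbit (j + suc r)                ≡⟨ iter-+ β j (suc r) a ⟩
    iter β j (orbit (suc r))         ≡⟨ cong (iter β j) (proj₁ (proj₂ cyc)) ⟩
    orbit j                          ∎
    where open ≡-Reasoning

  orbit-% : ∀ j → orbit j ≡ orbit (j % suc r)
  orbit-% j = trans (cong orbit (m≡m%n+[m/n]*n j (suc r))) (orbit-+-multiple (j / suc r) (j % suc r))

  orbit-pred : ∀ j → orbit j ≡ β (orbit (j + r))
  orbit-pred j = trans (sym (orbit-+-multiple 1 j)) (cong orbit (trans (cong (j +_) (+-identityʳ (suc r))) (+-suc j r)))

  private
    orbit-injective-< : ∀ {i j} → i < j → j < suc r → orbit i ≢ orbit j
    orbit-injective-< {i} {j} i<j j<m e = proj₂ (proj₂ cyc) (j ∸ i) (m<n⇒0<n∸m i<j) (≤-<-trans (m∸n≤m j i) j<m)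
      (iter-injective β β-inj i (trans (sym (iter-+ β i (j ∸ i) a)) (trans (cong orbit (m+[n∸m]≡n (<⇒≤ i<j))) (sym e))))

  orbit-injective : ∀ {i j} → i < suc r → j < suc r → orbit i ≡ orbit j → i ≡ j
  orbit-injective {i} {j} i<m j<m e with <-cmp i j
  ... | tri< i<j _ _ = ⊥-elim (orbit-injective-< i<j j<m e)
  ... | tri≈ _ i≡j _ = i≡j
  ... | tri> _ _ j<i = ⊥-elim (orbit-injective-< j<i i<m (sym e))

  inOrbit? : ∀ z → Dec (InOrbit β a z)
  inOrbit? z = map′ (λ (j , e) → toℕ j , e)
    (λ (j , e) → fromℕ< (m%n<n j (suc r)) , trans (cong orbit (F.toℕ-fromℕ< (m%n<n j (suc r)))) (trans (sym (orbit-% j)) e))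
    (F.any? λ (j : Fin (suc r)) → orbit (toℕ j) F.≟ z)

  ∉orbit-β : ∀ {z} → ¬ InOrbit β a z → ¬ InOrbit β a (β z)
  ∉orbit-β z∉ (j , e) = z∉ (j + r , β-inj _ _ (trans (sym (orbit-pred j)) e))

module _ {n} {β : Fin n → Fin n} (β-inj : IsPerm β) {a : Fin n} {r : ℕ} (cyc : IsCycleLen β a (suc r)) where
  open Orbit β-inj cyc

  -- shift r acts as β⁻¹ on the cycle of a and as the identity elsewhere.
  private
    shiftTranspositions : ℕ → List (Fin n × Fin n)
    shiftTranspositions = applyDownFrom (λ j → orbit j , orbit (suc j))

    shift : ℕ → Fin n → Fin n
    shift k = transpositionProduct (shiftTranspositions k)

    shift-orbit-zero : ∀ k → shift k (orbit 0) ≡ orbit k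
    shift-orbit-zero zero    = refl
    shift-orbit-zero (suc k) =
      trans (cong (transpose (orbit k) (orbit (suc k))) (shift-orbit-zero k)) (transpose-matchˡ (orbit k) (orbit (suc k)))

    shift-fixes : ∀ k {z} → (∀ j → j ≤ k → orbit j ≢ z) → shift k z ≡ z
    shift-fixes zero    _ = refl
    shift-fixes (suc k) {z} z∉ =
      trans (cong (transpose (orbit k) (orbit (suc k))) (shift-fixes k (λ j j≤k → z∉ j (m≤n⇒m≤1+n j≤k))))
            (transpose-fixes _ _ (λ e → z∉ k (n≤1+n k) (sym e)) (λ e → z∉ (suc k) ≤-refl (sym e)))

    orbit-≢ : ∀ {i j} → i < suc r → j < suc r → i ≢ j → orbit i ≢ orbit j
    orbit-≢ i<m j<m i≢j = i≢j ∘ orbit-injective i<m j<m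

    shift-orbit-suc : ∀ k → k ≤ r → ∀ j → j < k → shift k (orbit (suc j)) ≡ orbit j
    shift-orbit-suc (suc k) 1+k≤r j j<1+k with m≤n⇒m<n∨m≡n (≤-pred j<1+k)
    ... | inj₁ j<k =
      trans (cong (transpose (orbit k) (orbit (suc k))) (shift-orbit-suc k (<⇒≤ 1+k≤r) j j<k))
            (transpose-fixes _ _ (orbit-≢ j<m k<m (<⇒≢ j<k)) (orbit-≢ j<m (s≤s 1+k≤r) (<⇒≢ (m<n⇒m<1+n j<k))))
      where
        k<m = s≤s (<⇒≤ 1+k≤r)
        j<m = <-trans j<k k<m
    ... | inj₂ refl =
      trans (cong (transpose (orbit j) (orbit (suc j)))
                  (shift-fixes j λ i i≤j → orbit-≢ (s≤s (≤-trans i≤j (<⇒≤ 1+k≤r))) (s≤s 1+k≤r) (<⇒≢ (s≤s i≤j))))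
            (transpose-matchʳ (orbit j) (orbit (suc j)))

    shiftTranspositions-distinct : ∀ k → k ≤ r → All (λ (i , j) → i ≢ j) (shiftTranspositions k)
    shiftTranspositions-distinct zero    _ = []
    shiftTranspositions-distinct (suc k) 1+k≤r =
      orbit-≢ (s≤s (<⇒≤ 1+k≤r)) (s≤s 1+k≤r) (<⇒≢ (n<1+n k)) ∷ shiftTranspositions-distinct k (<⇒≤ 1+k≤r)

    shift-pred : ∀ j → shift r (orbit (suc j)) ≡ orbit j
    shift-pred j with m≤n⇒m<n∨m≡n (≤-pred (m%n<n j (suc r)))
    ... | inj₁ j%m<r = begin
      shift r (β (orbit j))           ≡⟨ cong (shift r ∘ β) (orbit-% j) ⟩
      shift r (orbit (suc (j % suc r))) ≡⟨ shift-orbit-suc r ≤-refl (j % suc r) j%m<r ⟩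
      orbit (j % suc r)               ≡⟨ orbit-% j ⟨
      orbit j                         ∎
      where open ≡-Reasoning
    ... | inj₂ j%m≡r = begin
      shift r (β (orbit j))           ≡⟨ cong (shift r ∘ β) (trans (orbit-% j) (cong orbit j%m≡r)) ⟩
      shift r (orbit (suc r))         ≡⟨ cong (shift r) (proj₁ (proj₂ cyc)) ⟩
      shift r (orbit 0)               ≡⟨ shift-orbit-zero r ⟩
      orbit r                         ≡⟨ trans (orbit-% j) (cong orbit j%m≡r) ⟨
      orbit j                         ∎
      where open ≡-Reasoning

  evenCycle⇒oddCommuting : parity r ≡ 1ℙ → OddCommutingPermutation β
  evenCycle⇒oddCommuting r-odd = record
    { transpositions = shiftTranspositions r
    ; distinct = shiftTranspositions-distinct r ≤-refl
    ; odd = trans (cong parity (length-applyDownFrom _ r)) r-odd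
    ; commutes = commutes
    }
    where
      commutes : ∀ z → shift r (β z) ≡ β (shift r z)
      commutes z with inOrbit? z
      ... | yes (j , refl) = begin
        shift r (orbit (suc j))          ≡⟨ shift-pred j ⟩
        orbit j                          ≡⟨ orbit-pred j ⟩
        β (orbit (j + r))                ≡⟨ cong β (shift-pred (j + r)) ⟨
        β (shift r (orbit (suc (j + r)))) ≡⟨ cong (β ∘ shift r) (orbit-pred j) ⟨
        β (shift r (orbit j))            ∎
        where open ≡-Reasoning
      ... | no z∉ = trans (shift-fixes r (λ j _ e → ∉orbit-β z∉ (j , e)))
                          (cong β (sym (shift-fixes r (λ j _ e → z∉ (j , e)))))

module _ {n} {β : Fin n → Fin n} (β-inj : IsPerm β) {a b : Fin n} {r : ℕ}
         (cyc-a : IsCycleLen β a (suc r)) (cyc-b : IsCycleLen β b (suc r)) (b∉a : ¬ InOrbit β a b) where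
  private
    module A = Orbit β-inj cyc-a
    module B = Orbit β-inj cyc-b

    -- β^(r j) carries B.orbit j back to b, as (r + 1) j is a multiple of the period.
    orbits-disjoint : ∀ i j → A.orbit i ≢ B.orbit j
    orbits-disjoint i j e = b∉a (r * j + i , (begin
      iter β (r * j + i) a       ≡⟨ iter-+ β (r * j) i a ⟩
      iter β (r * j) (A.orbit i) ≡⟨ cong (iter β (r * j)) e ⟩
      iter β (r * j) (B.orbit j) ≡⟨ iter-+ β (r * j) j b ⟨
      iter β (r * j + j) b       ≡⟨ cong (λ m → iter β m b) r*j+j≡j*[1+r] ⟩
      B.orbit (0 + j * suc r)    ≡⟨ B.orbit-+-multiple j 0 ⟩
      b                          ∎))
      where
        open ≡-Reasoning
        r*j+j≡j*[1+r] : r * j + j ≡ j * suc r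
        r*j+j≡j*[1+r] = trans (+-comm (r * j) j) (trans (cong (j +_) (*-comm r j)) (sym (*-suc j r)))

    swapTranspositions : ℕ → List (Fin n × Fin n)
    swapTranspositions = applyDownFrom (λ j → A.orbit j , B.orbit j)

    swap : ℕ → Fin n → Fin n
    swap k = transpositionProduct (swapTranspositions k)

    swap-fixes : ∀ k {z} → (∀ j → j < k → A.orbit j ≢ z) → (∀ j → j < k → B.orbit j ≢ z) → swap k z ≡ z
    swap-fixes zero    _ _ = refl
    swap-fixes (suc k) z∉A z∉B =
      trans (cong (transpose (A.orbit k) (B.orbit k))
                  (swap-fixes k (λ j → z∉A j ∘ m<n⇒m<1+n) (λ j → z∉B j ∘ m<n⇒m<1+n)))
            (transpose-fixes _ _ (z∉A k ≤-refl ∘ sym) (z∉B k ≤-refl ∘ sym))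

    swap-orbitᴬ : ∀ k → k ≤ suc r → ∀ j → j < k → swap k (A.orbit j) ≡ B.orbit j
    swap-orbitᴬ (suc k) 1+k≤m j j<1+k with m≤n⇒m<n∨m≡n (≤-pred j<1+k)
    ... | inj₁ j<k = trans (cong (transpose (A.orbit k) (B.orbit k)) (swap-orbitᴬ k (<⇒≤ 1+k≤m) j j<k))
      (transpose-fixes _ _ (orbits-disjoint k j ∘ sym) (<⇒≢ j<k ∘ B.orbit-injective (<-trans j<k 1+k≤m) 1+k≤m))
    ... | inj₂ refl = trans (cong (transpose (A.orbit j) (B.orbit j))
        (swap-fixes j (λ i i<j → <⇒≢ i<j ∘ A.orbit-injective (<-trans i<j 1+k≤m) 1+k≤m)
                      (λ i _ → orbits-disjoint j i ∘ sym)))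
      (transpose-matchˡ (A.orbit j) (B.orbit j))

    swap-orbitᴮ : ∀ k → k ≤ suc r → ∀ j → j < k → swap k (B.orbit j) ≡ A.orbit j
    swap-orbitᴮ (suc k) 1+k≤m j j<1+k with m≤n⇒m<n∨m≡n (≤-pred j<1+k)
    ... | inj₁ j<k = trans (cong (transpose (A.orbit k) (B.orbit k)) (swap-orbitᴮ k (<⇒≤ 1+k≤m) j j<k))
      (transpose-fixes _ _ (<⇒≢ j<k ∘ A.orbit-injective (<-trans j<k 1+k≤m) 1+k≤m) (orbits-disjoint j k))
    ... | inj₂ refl = trans (cong (transpose (A.orbit j) (B.orbit j))
        (swap-fixes j (λ i _ → orbits-disjoint i j)
                      (λ i i<j → <⇒≢ i<j ∘ B.orbit-injective (<-trans i<j 1+k≤m) 1+k≤m)))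
      (transpose-matchʳ (A.orbit j) (B.orbit j))

    swapTranspositions-distinct : ∀ k → All (λ (i , j) → i ≢ j) (swapTranspositions k)
    swapTranspositions-distinct zero    = []
    swapTranspositions-distinct (suc k) = orbits-disjoint k k ∷ swapTranspositions-distinct k

    swapᴬ : ∀ j → swap (suc r) (A.orbit j) ≡ B.orbit j
    swapᴬ j = trans (cong (swap (suc r)) (A.orbit-% j))
                    (trans (swap-orbitᴬ (suc r) ≤-refl (j % suc r) (m%n<n j (suc r))) (sym (B.orbit-% j)))

    swapᴮ : ∀ j → swap (suc r) (B.orbit j) ≡ A.orbit j
    swapᴮ j = trans (cong (swap (suc r)) (B.orbit-% j))
                    (trans (swap-orbitᴮ (suc r) ≤-refl (j % suc r) (m%n<n j (suc r))) (sym (A.orbit-% j)))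

  equalOddCycles⇒oddCommuting : parity (suc r) ≡ 1ℙ → OddCommutingPermutation β
  equalOddCycles⇒oddCommuting m-odd = record
    { transpositions = swapTranspositions (suc r)
    ; distinct = swapTranspositions-distinct (suc r)
    ; odd = trans (cong parity (length-applyDownFrom _ (suc r))) m-odd
    ; commutes = commutes
    }
    where
      commutes : ∀ z → swap (suc r) (β z) ≡ β (swap (suc r) z)
      commutes z with A.inOrbit? z | B.inOrbit? z
      ... | yes (j , refl) | _ = trans (swapᴬ (suc j)) (cong β (sym (swapᴬ j)))
      ... | no _ | yes (j , refl) = trans (swapᴮ (suc j)) (cong β (sym (swapᴮ j)))
      ... | no z∉A | no z∉B =
        trans (swap-fixes (suc r) (λ j _ e → A.∉orbit-β z∉A (j , e)) (λ j _ e → B.∉orbit-β z∉B (j , e)))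
              (cong β (sym (swap-fixes (suc r) (λ j _ e → z∉A (j , e)) (λ j _ e → z∉B (j , e)))))

module _ {n} {β : Fin n → Fin n} (β-inj : IsPerm β) where
  private
    ℓ : Fin n → ℕ
    ℓ a = proj₁ (cycleLength β β-inj a)

    ℓ-cycle : ∀ a → IsCycleLen β a (ℓ a)
    ℓ-cycle a = proj₂ (cycleLength β β-inj a)

    inOrbit? : ∀ a z → Dec (InOrbit β a z)
    inOrbit? a z = go (ℓ-cycle a)
      where
        go : ∀ {m} → IsCycleLen β a m → Dec (InOrbit β a z)
        go {suc r} cyc = Orbit.inOrbit? β-inj cyc z

    evenCycle : ∀ {a m} → IsCycleLen β a m → ¬ (m % 2 ≡ 1) → OddCommutingPermutation β
    evenCycle {m = suc r} cyc m-even = evenCycle⇒oddCommuting β-inj cyc (pred-of-even⇒parity≡1ℙ r m-even)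

    equalOddCycles : ∀ {a b m} → IsCycleLen β a m → IsCycleLen β b m → m % 2 ≡ 1 → ¬ InOrbit β a b →
      OddCommutingPermutation β
    equalOddCycles {m = suc r} cyc-a cyc-b m-odd b∉a =
      equalOddCycles⇒oddCommuting β-inj cyc-a cyc-b b∉a (%2≡1⇒parity≡1ℙ (suc r) m-odd)

  -- The hypothesis is only a refutation; the even cycle or the two equal odd cycles are found by
  -- exhaustive search, using computed cycle lengths and decidable orbit membership.
  ¬DistinctOddCycleType⇒oddCommuting : ¬ DistinctOddCycleType β → OddCommutingPermutation β
  ¬DistinctOddCycleType⇒oddCommuting ¬distinct = by-parity (F.any? λ a → ¬? (ℓ a % 2 ≟ℕ 1))
    where
      by-parity : Dec (∃[ a ] ¬ (ℓ a % 2 ≡ 1)) → OddCommutingPermutation β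
      by-parity (yes (a , ℓa-even)) = evenCycle (ℓ-cycle a) ℓa-even
      by-parity (no ∄even) = by-orbits (F.any? λ a → F.any? λ b → (ℓ a ≟ℕ ℓ b) ×-dec ¬? (inOrbit? a b))
        where
          ℓ-odd : ∀ a → ℓ a % 2 ≡ 1
          ℓ-odd a = decidable-stable (ℓ a % 2 ≟ℕ 1) (λ ℓa-even → ∄even (a , ℓa-even))

          by-orbits : Dec (∃[ a ] ∃[ b ] ℓ a ≡ ℓ b × ¬ InOrbit β a b) → OddCommutingPermutation β
          by-orbits (yes (a , b , ℓa≡ℓb , b∉a)) =
            equalOddCycles (ℓ-cycle a) (subst (IsCycleLen β b) (sym ℓa≡ℓb) (ℓ-cycle b)) (ℓ-odd a) b∉a
          by-orbits (no ∄) = ⊥-elim (¬distinct (all-odd , same-length⇒same-orbit))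
            where
              all-odd : ∀ a m → IsCycleLen β a m → m % 2 ≡ 1
              all-odd a m cyc = subst (λ m → m % 2 ≡ 1) (IsCycleLen-unique β (ℓ-cycle a) cyc) (ℓ-odd a)
              same-length⇒same-orbit : ∀ a b m → IsCycleLen β a m → IsCycleLen β b m → InOrbit β a b
              same-length⇒same-orbit a b m cyc-a cyc-b = decidable-stable (inOrbit? a b) λ b∉a →
                ∄ (a , b , trans (IsCycleLen-unique β (ℓ-cycle a) cyc-a) (IsCycleLen-unique β cyc-b (ℓ-cycle b)) , b∉a)

proposition12 : (n : ℕ) (β : Fin n → Fin n) → IsPerm β →
    ¬ DistinctOddCycleType β →
    (k : ℕ) → 2 * count isOdd? (C k β) ≡ length (C k β)
proposition12 n β β-inj ¬distinct = half-of-C-odd (¬DistinctOddCycleType⇒oddCommuting β-inj ¬distinct)
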